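{- Let $G=(V,E)$ be a graph and $f,g$ consistent $2$-colorings of $G$. Let $V_s=\{u\mid f(u)=1,\ g(u)=2\}$, $V_t=\{u\mid f(u)=2,\ g(u)=1\}$, $V_1=\{u\mid f(u)=g(u)=1\}$, $V_2=\{u\mid f(u)=g(u)=2\}$. Let $H$ be the directed graph on vertex set $V\cup\{s,t\}$ (with new vertices $s,t$) whose arc set consists of all arcs $(u,v)$ with $\{u,v\}\in E$ and $(u,v)\in (V_s\times V_t)\cup(V_s\times(V_1\cup V_2))\cup((V_1\cup V_2)\times V_t)\cup(V_1\times V_2)\cup(V_2\times V_1)$, together with all arcs $(s,u)$ for $u\in V_s$ and $(u,t)$ for $u\in V_t$. Then there exist matchings $S_1,S_2\subseteq E$ with $f\langle S_1,S_2\rangle=g$ if and only if $H$ contains $|V_s|$ directed $s$-$t$ paths that are pairwise vertex-disjoint except at $s$ and $t$.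
   Context: A $2$-coloring is a map $f:V\to\{1,2\}$; $f,g$ are consistent if $|f^{ -1}(i)|=|g^{ -1}(i)|$ for $i=1,2$. For a matching $S\subseteq E$, $fS(u)=f(v)$ if $\{u,v\}\in S$ and $fS(u)=f(u)$ if $u$ is covered by no edge of $S$; $f\langle S_1,S_2\rangle=(fS_1)S_2$. -}

module Defs where

open import Data.Nat using (ℕ)
open import Data.Fin using (Fin)
open import Data.List using (List; []; _∷_; length; filter; allFin)
open import Data.List.Membership.Propositional using (_∈_)
open import Data.List.Relation.Unary.Unique.Propositional using (Unique)
open import Data.Maybe using (Maybe; just; nothing)
open import Data.Product using (_×_; Σ)
open import Data.Sum using (_⊎_; inj₁; inj₂)
open import Data.Empty using (⊥)
open import Data.Unit using (⊤)
open import Relation.Nullary using (¬_; Dec; yes; no)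
open import Relation.Nullary.Decidable using (_×-dec_)
open import Relation.Binary.PropositionalEquality using (_≡_; _≢_; refl)

record Graph (n : ℕ) : Set₁ where
  field
    Adj    : Fin n → Fin n → Set
    sym    : ∀ {u v} → Adj u v → Adj v u
    irrefl : ∀ {u} → ¬ Adj u u
open Graph public

data Color : Set where
  c1 c2 : Color

_≟ᶜ_ : (a b : Color) → Dec (a ≡ b)
c1 ≟ᶜ c1 = yes refl
c1 ≟ᶜ c2 = no (λ ())
c2 ≟ᶜ c1 = no (λ ())
c2 ≟ᶜ c2 = yes refl

Coloring : ℕ → Set
Coloring n = Fin n → Color

countColor : ∀ {n} → Coloring n → Color → ℕ
countColor {n} f i = length (filter (λ u → f u ≟ᶜ i) (allFin n))

Consistent : ∀ {n} → Coloring n → Coloring n → Set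
Consistent f g = (countColor f c1 ≡ countColor g c1) × (countColor f c2 ≡ countColor g c2)

-- A matching S ⊆ E, encoded by its partner map: m u = just v iff {u,v} ∈ S.
record Matching {n : ℕ} (G : Graph n) : Set where
  field
    partner  : Fin n → Maybe (Fin n)
    inv      : ∀ {u v} → partner u ≡ just v → partner v ≡ just u
    inEdges  : ∀ {u v} → partner u ≡ just v → Adj G u v
open Matching public

apply : ∀ {n} {G : Graph n} → Coloring n → Matching G → Coloring n
apply f S u with partner S u
... | just v  = f v
... | nothing = f u

apply₂ : ∀ {n} {G : Graph n} → Coloring n → Matching G → Matching G → Coloring n
apply₂ f S₁ S₂ = apply (apply f S₁) S₂

countVs : ∀ {n} → Coloring n → Coloring n → ℕ
countVs {n} f g = length (filter (λ u → (f u ≟ᶜ c1) ×-dec (g u ≟ᶜ c2)) (allFin n))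

data Class : Set where
  Vs Vt V1 V2 : Class

cls : Color → Color → Class
cls c1 c2 = Vs
cls c2 c1 = Vt
cls c1 c1 = V1
cls c2 c2 = V2

ArcOK : Class → Class → Set
ArcOK Vs Vt = ⊤
ArcOK Vs V1 = ⊤
ArcOK Vs V2 = ⊤
ArcOK V1 Vt = ⊤
ArcOK V2 Vt = ⊤
ArcOK V1 V2 = ⊤
ArcOK V2 V1 = ⊤
ArcOK _  _  = ⊥

data ST : Set where
  s t : ST

HV : ℕ → Set
HV n = Fin n ⊎ ST

Arc : ∀ {n} → Graph n → Coloring n → Coloring n → HV n → HV n → Set
Arc G f g (inj₁ u) (inj₁ v) = Adj G u v × ArcOK (cls (f u) (g u)) (cls (f v) (g v))
Arc G f g (inj₂ s) (inj₁ v) = cls (f v) (g v) ≡ Vs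
Arc G f g (inj₁ u) (inj₂ t) = cls (f u) (g u) ≡ Vt
Arc G f g _        _        = ⊥

-- A walk x → u₁ → … → u_k → t in H, given by its list of inner vertices.
WalkTo-t : ∀ {n} → Graph n → Coloring n → Coloring n → HV n → List (Fin n) → Set
WalkTo-t G f g x []       = Arc G f g x (inj₂ t)
WalkTo-t G f g x (u ∷ us) = Arc G f g x (inj₁ u) × WalkTo-t G f g (inj₁ u) us

STPath : ∀ {n} → Graph n → Coloring n → Coloring n → List (Fin n) → Set
STPath G f g p = WalkTo-t G f g (inj₂ s) p × Unique p

DisjointPaths : ∀ {n} → Graph n → Coloring n → Coloring n → ℕ → Set
DisjointPaths {n} G f g k =
  Σ (Fin k → List (Fin n)) λ P →
    (∀ i → STPath G f g (P i)) ×
    (∀ i j → i ≢ j → ∀ u → u ∈ P i → u ∈ P j → ⊥)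

-- Write σ₁, σ₂ for the involutions exchanging the ends of the edges of S₁, S₂; then f⟨S₁,S₂⟩ = f ∘ σ₁ ∘ σ₂.
-- Given S₁, S₂ with f⟨S₁,S₂⟩ = g, send each vertex that receives colour 2 in one of the two steps to the
-- vertex it receives it from.  This partial map is injective, its steps are arcs of H, nothing is sent
-- into V_s, and an orbit starting in V_s halts only in V_t; these orbits are the paths.
-- Conversely, every arc of H raises f from 1 to 2 or lowers g from 2 to 1, and two consecutive arcs of
-- a path cannot do the same; so the raising links of the paths form a matching S₁ and the lowering ones
-- a matching S₂.  Consistency gives |V_t| = |V_s|, hence by pigeonhole the paths cover V_s ∪ V_t, and
-- inspecting the path through each vertex shows f ∘ σ₁ ∘ σ₂ = g.

module Submission where

open import Defs hiding (sym)
open import Data.Bool using (Bool; true; false)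
import Data.Bool.Properties as Bool
open import Data.Empty using (⊥; ⊥-elim)
open import Data.Fin using (Fin; zero; suc; toℕ; _≟_)
open import Data.Fin.Properties using (any?; injective⇒≤; toℕ-injective; toℕ≤pred[n])
open import Data.List using (List; []; _∷_; length; filter; allFin; lookup)
open import Data.List.Membership.Propositional using (_∈_)
open import Data.List.Membership.Propositional.Properties using (∈-filter⁺; ∈-filter⁻; ∈-allFin; ∈-lookup)
import Data.List.Membership.DecPropositional as DecMembership
open import Data.List.Properties using (filter-≐)
open import Data.List.Relation.Unary.All as All using ()
open import Data.List.Relation.Unary.Any using (here; there; index)
open import Data.List.Relation.Unary.Any.Properties using (lookup-index)
open import Data.List.Relation.Unary.Unique.Propositional using (Unique; []; _∷_)
open import Data.List.Relation.Unary.Unique.Propositional.Properties using (Unique[x∷xs]⇒x∉xs; filter⁺; allFin⁺)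
open import Data.Maybe using (Maybe; just; nothing; _>>=_)
open import Data.Nat using (ℕ; zero; suc; _+_; _∸_; _≤_; _<_)
open import Data.Nat.Properties using (+-suc; +-identityʳ; +-cancelʳ-≡; <-irrefl; ≤-refl; ≤-reflexive; <⇒≤; m∸n+n≡m; ≤⇒≯)
open import Data.Product using (_×_; _,_; proj₁; proj₂; ∃; ∃₂; swap)
open import Data.Product.Properties using (≡-dec)
open import Data.Sum using (_⊎_; inj₁; inj₂) renaming (swap to ⊎-swap)
open import Function using (_∘_)
open import Function.Bundles using (_⇔_; mk⇔)
open import Relation.Nullary using (¬_; Dec; yes; no)
open import Relation.Nullary.Decidable using (_×-dec_; _⊎-dec_)
open import Relation.Unary using (Decidable)
open import Relation.Binary.PropositionalEquality using (_≡_; _≢_; refl; sym; trans; cong; subst; module ≡-Reasoning)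

mate : ∀ {n} {G : Graph n} → Matching G → Fin n → Fin n
mate S u with partner S u
... | just v  = v
... | nothing = u

module _ {n} {G : Graph n} (S : Matching G) where

  apply-mate : ∀ (f : Coloring n) u → apply f S u ≡ f (mate S u)
  apply-mate f u with partner S u
  ... | just _  = refl
  ... | nothing = refl

  mate-just : ∀ {u v} → partner S u ≡ just v → mate S u ≡ v
  mate-just {u} eq with partner S u
  mate-just refl | just _ = refl

  mate-nothing : ∀ {u} → partner S u ≡ nothing → mate S u ≡ u
  mate-nothing {u} eq with partner S u
  mate-nothing refl | nothing = refl

  mate-involutive : ∀ u → mate S (mate S u) ≡ u
  mate-involutive u with partner S u in eq
  ... | just v  = mate-just (inv S eq)
  ... | nothing = mate-nothing eq

  mate-injective : ∀ {u v} → mate S u ≡ mate S v → u ≡ v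
  mate-injective {u} {v} eq = trans (sym (mate-involutive u)) (trans (cong (mate S) eq) (mate-involutive v))

  mate-adjacent : ∀ u → mate S u ≢ u → Adj G u (mate S u)
  mate-adjacent u moved with partner S u in eq
  ... | just v  = inEdges S eq
  ... | nothing = ⊥-elim (moved refl)

apply₂-mate : ∀ {n} {G : Graph n} (S T : Matching G) (f : Coloring n) u → apply₂ f S T u ≡ f (mate S (mate T u))
apply₂-mate S T f u = trans (apply-mate T (apply f S) u) (apply-mate S f (mate T u))

module FromRelation {n} (G : Graph n) (R : Fin n → Fin n → Set) (R? : ∀ u v → Dec (R u v))
         (R-sym : ∀ {u v} → R u v → R v u)
         (R-functional : ∀ {u v w} → R u v → R u w → v ≡ w)
         (R⇒Adj : ∀ {u v} → R u v → Adj G u v) where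

  private
    partnerOf : Fin n → Maybe (Fin n)
    partnerOf u with any? (R? u)
    ... | yes (v , _) = just v
    ... | no _        = nothing

    partnerOf-sound : ∀ {u v} → partnerOf u ≡ just v → R u v
    partnerOf-sound {u} eq with any? (R? u)
    partnerOf-sound refl | yes (_ , r) = r

    partnerOf-complete : ∀ {u v} → R u v → partnerOf u ≡ just v
    partnerOf-complete {u} r with any? (R? u)
    ... | yes (_ , r′) = cong just (R-functional r′ r)
    ... | no ∄r        = ⊥-elim (∄r (_ , r))

    partnerOf-none : ∀ {u} → (∀ v → ¬ R u v) → partnerOf u ≡ nothing
    partnerOf-none {u} ∄r with any? (R? u)
    ... | yes (v , r) = ⊥-elim (∄r v r)
    ... | no _        = refl

  matching : Matching G
  matching = record
    { partner = partnerOf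
    ; inv     = λ eq → partnerOf-complete (R-sym (partnerOf-sound eq))
    ; inEdges = λ eq → R⇒Adj (partnerOf-sound eq)
    }

  mate-matching : ∀ {u v} → R u v → mate matching u ≡ v
  mate-matching r = mate-just matching (partnerOf-complete r)

  mate-unrelated : ∀ {u} → (∀ v → ¬ R u v) → mate matching u ≡ u
  mate-unrelated ∄r = mate-nothing matching (partnerOf-none ∄r)

lookup-injective : ∀ {A : Set} {xs : List A} → Unique xs → ∀ i j → lookup xs i ≡ lookup xs j → i ≡ j
lookup-injective {xs = _ ∷ _} _          zero    zero    _  = refl
lookup-injective {xs = _ ∷ _} (x∉ ∷ _)   zero    (suc j) eq = ⊥-elim (All.lookup x∉ (∈-lookup j) eq)
lookup-injective {xs = _ ∷ _} (x∉ ∷ _)   (suc i) zero    eq = ⊥-elim (All.lookup x∉ (∈-lookup i) (sym eq))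
lookup-injective {xs = _ ∷ _} (_ ∷ uniq) (suc i) (suc j) eq = cong suc (lookup-injective uniq i j eq)

PairwiseDisjoint : ∀ {A : Set} {k} → (Fin k → List A) → Set
PairwiseDisjoint L = ∀ i j → i ≢ j → ∀ u → u ∈ L i → u ∈ L j → ⊥

-- An uncovered u, together with a Q-element of each list, would give k + 1 distinct elements of Q.
disjoint-cover : ∀ {n k} {Q : Fin n → Set} (Q? : Decidable Q) (L : Fin k → List (Fin n)) →
                 PairwiseDisjoint L → (∀ i → ∃ λ x → x ∈ L i × Q x) →
                 length (filter Q? (allFin n)) ≤ k → ∀ {u} → Q u → ∃ λ i → u ∈ L i
disjoint-cover {n} {k} {Q} Q? L disjoint witness bound {u} qu with any? (λ i → u ∈? L i)
  where open DecMembership (_≟_ {n})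
... | yes covered  = covered
... | no uncovered = ⊥-elim (≤⇒≯ bound (injective⇒≤ slot-injective))
  where
  slotOf : ∀ x → Q x → Fin (length (filter Q? (allFin n)))
  slotOf x qx = index (∈-filter⁺ Q? (∈-allFin x) qx)

  slotOf-injective : ∀ {x y qx qy} → slotOf x qx ≡ slotOf y qy → x ≡ y
  slotOf-injective {x} {y} {qx} {qy} eq =
    trans (lookup-index (∈-filter⁺ Q? (∈-allFin x) qx))
          (trans (cong (lookup (filter Q? (allFin n))) eq) (sym (lookup-index (∈-filter⁺ Q? (∈-allFin y) qy))))

  slot : Fin (suc k) → Fin (length (filter Q? (allFin n)))
  slot zero    = slotOf u qu
  slot (suc i) = slotOf (proj₁ (witness i)) (proj₂ (proj₂ (witness i)))

  slot-injective : ∀ {i j} → slot i ≡ slot j → i ≡ j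
  slot-injective {zero}  {zero}  _  = refl
  slot-injective {zero}  {suc j} eq = ⊥-elim (uncovered (j , subst (_∈ L j) (sym (slotOf-injective eq)) (proj₁ (proj₂ (witness j)))))
  slot-injective {suc i} {zero}  eq = ⊥-elim (uncovered (i , subst (_∈ L i) (slotOf-injective eq) (proj₁ (proj₂ (witness i)))))
  slot-injective {suc i} {suc j} eq with i ≟ j
  ... | yes i≡j = cong suc i≡j
  ... | no i≢j  = ⊥-elim (disjoint i j i≢j _ (proj₁ (proj₂ (witness i)))
                            (subst (_∈ L j) (sym (slotOf-injective eq)) (proj₁ (proj₂ (witness j)))))

links : ∀ {A : Set} → List A → List (A × A)
links []           = []
links (x ∷ [])     = []
links (x ∷ y ∷ ys) = (x , y) ∷ links (y ∷ ys)

module _ {A : Set} where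

  ∈-links⁻ : ∀ xs {u v : A} → (u , v) ∈ links xs → u ∈ xs × v ∈ xs
  ∈-links⁻ (x ∷ y ∷ ys) (here refl) = here refl , there (here refl)
  ∈-links⁻ (x ∷ y ∷ ys) (there uv)  with ∈-links⁻ (y ∷ ys) uv
  ... | u∈ , v∈ = there u∈ , there v∈

  ∈-links-tail : ∀ (x : A) xs {u v} → (u , v) ∈ links (x ∷ xs) → v ∈ xs
  ∈-links-tail x (y ∷ ys) (here refl) = here refl
  ∈-links-tail x (y ∷ ys) (there uv)  = there (∈-links-tail y ys uv)

  links-functional : ∀ xs → Unique xs → ∀ {u v w : A} → (u , v) ∈ links xs → (u , w) ∈ links xs → v ≡ w
  links-functional (x ∷ y ∷ ys) _           (here refl) (here refl) = refl
  links-functional (x ∷ y ∷ ys) uniq        (here refl) (there uw)  = ⊥-elim (Unique[x∷xs]⇒x∉xs uniq (proj₁ (∈-links⁻ (y ∷ ys) uw)))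
  links-functional (x ∷ y ∷ ys) uniq        (there uv)  (here refl) = ⊥-elim (Unique[x∷xs]⇒x∉xs uniq (proj₁ (∈-links⁻ (y ∷ ys) uv)))
  links-functional (x ∷ y ∷ ys) (_ ∷ uniq)  (there uv)  (there uw)  = links-functional (y ∷ ys) uniq uv uw

  links-injective : ∀ xs → Unique xs → ∀ {u v w : A} → (u , w) ∈ links xs → (v , w) ∈ links xs → u ≡ v
  links-injective (x ∷ y ∷ ys) _           (here refl) (here refl) = refl
  links-injective (x ∷ y ∷ ys) (_ ∷ uniq)  (here refl) (there vw)  = ⊥-elim (Unique[x∷xs]⇒x∉xs uniq (∈-links-tail y ys vw))
  links-injective (x ∷ y ∷ ys) (_ ∷ uniq)  (there uw)  (here refl) = ⊥-elim (Unique[x∷xs]⇒x∉xs uniq (∈-links-tail y ys uw))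
  links-injective (x ∷ y ∷ ys) (_ ∷ uniq)  (there uw)  (there vw)  = links-injective (y ∷ ys) uniq uw vw

  ∈⇒head⊎linked : ∀ (x : A) xs {u} → u ∈ x ∷ xs → u ≡ x ⊎ ∃ λ w → (w , u) ∈ links (x ∷ xs)
  ∈⇒head⊎linked x xs       (here u≡x) = inj₁ u≡x
  ∈⇒head⊎linked x (y ∷ ys) (there u∈) with ∈⇒head⊎linked y ys u∈
  ... | inj₁ refl       = inj₂ (x , here refl)
  ... | inj₂ (w , wu)   = inj₂ (w , there wu)

c1≢c2 : c1 ≢ c2
c1≢c2 ()

cls≡Vs⁻ : ∀ {a b} → cls a b ≡ Vs → a ≡ c1 × b ≡ c2
cls≡Vs⁻ {c1} {c2} _ = refl , refl
cls≡Vs⁻ {c1} {c1} ()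
cls≡Vs⁻ {c2} {c1} ()
cls≡Vs⁻ {c2} {c2} ()

cls≡Vs⁺ : ∀ {a b} → a ≡ c1 → b ≡ c2 → cls a b ≡ Vs
cls≡Vs⁺ refl refl = refl

cls≡Vt⁻ : ∀ {a b} → cls a b ≡ Vt → a ≡ c2 × b ≡ c1
cls≡Vt⁻ {c2} {c1} _ = refl , refl
cls≡Vt⁻ {c1} {c1} ()
cls≡Vt⁻ {c1} {c2} ()
cls≡Vt⁻ {c2} {c2} ()

cls-unchanged : ∀ a b → cls a b ≢ Vs → cls a b ≢ Vt → a ≡ b
cls-unchanged c1 c1 _    _    = refl
cls-unchanged c2 c2 _    _    = refl
cls-unchanged c1 c2 ≢Vs _    = ⊥-elim (≢Vs refl)
cls-unchanged c2 c1 _    ≢Vt = ⊥-elim (≢Vt refl)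

¬ArcOK-into-Vs : ∀ x → ¬ ArcOK x Vs
¬ArcOK-into-Vs Vs ()
¬ArcOK-into-Vs Vt ()
¬ArcOK-into-Vs V1 ()
¬ArcOK-into-Vs V2 ()

¬ArcOK-from-Vt : ∀ y → ¬ ArcOK Vt y
¬ArcOK-from-Vt Vs ()
¬ArcOK-from-Vt Vt ()
¬ArcOK-from-Vt V1 ()
¬ArcOK-from-Vt V2 ()

-- The arcs of H between vertices of G are exactly those raising f from 1 to 2 or lowering g from 2 to 1.
ArcOK-raise : ∀ b d → ArcOK (cls c1 b) (cls c2 d)
ArcOK-raise c1 c1 = _
ArcOK-raise c1 c2 = _
ArcOK-raise c2 c1 = _
ArcOK-raise c2 c2 = _

ArcOK-lower : ∀ a c → ArcOK (cls a c2) (cls c c1)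
ArcOK-lower c1 c1 = _
ArcOK-lower c1 c2 = _
ArcOK-lower c2 c1 = _
ArcOK-lower c2 c2 = _

ArcOK⁻ : ∀ a b c d → ArcOK (cls a b) (cls c d) → (a ≡ c1 × c ≡ c2) ⊎ (b ≡ c2 × d ≡ c1)
ArcOK⁻ c1 b  c2 d  _ = inj₁ (refl , refl)
ArcOK⁻ a  c2 c  c1 _ = inj₂ (refl , refl)
ArcOK⁻ c1 c1 c1 c1 ()
ArcOK⁻ c1 c1 c1 c2 ()
ArcOK⁻ c1 c2 c1 c2 ()
ArcOK⁻ c2 c1 c1 c1 ()
ArcOK⁻ c2 c1 c1 c2 ()
ArcOK⁻ c2 c2 c1 c2 ()
ArcOK⁻ c2 c1 c2 c1 ()
ArcOK⁻ c2 c1 c2 c2 ()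
ArcOK⁻ c2 c2 c2 c2 ()

ArcOK⁺ : ∀ {a b c d} → (a ≡ c1 × c ≡ c2) ⊎ (b ≡ c2 × d ≡ c1) → ArcOK (cls a b) (cls c d)
ArcOK⁺ {b = b} {d = d} (inj₁ (refl , refl)) = ArcOK-raise b d
ArcOK⁺ {a = a} {c = c} (inj₂ (refl , refl)) = ArcOK-lower a c

raises : Color → Color → Bool
raises c1 c2 = true
raises _  _  = false

raises≡true : ∀ {a c} → raises a c ≡ true → a ≡ c1 × c ≡ c2
raises≡true {c1} {c2} _ = refl , refl
raises≡true {c1} {c1} ()
raises≡true {c2} {c1} ()
raises≡true {c2} {c2} ()

ArcOK-lowers : ∀ {a b c d} → ArcOK (cls a b) (cls c d) → raises a c ≡ false → b ≡ c2 × d ≡ c1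
ArcOK-lowers {a} {b} {c} {d} ok r with ArcOK⁻ a b c d ok
... | inj₂ lowers    = lowers
ArcOK-lowers _ () | inj₁ (refl , refl)

count-c1 : ∀ {n} (f g : Coloring n) xs →
           length (filter (λ u → f u ≟ᶜ c1) xs)
           ≡ length (filter (λ u → (f u ≟ᶜ c1) ×-dec (g u ≟ᶜ c2)) xs)
             + length (filter (λ u → (f u ≟ᶜ c1) ×-dec (g u ≟ᶜ c1)) xs)
count-c1 f g []       = refl
count-c1 f g (x ∷ xs) with f x | g x
... | c1 | c1 = trans (cong suc (count-c1 f g xs)) (sym (+-suc _ _))
... | c1 | c2 = cong suc (count-c1 f g xs)
... | c2 | _  = count-c1 f g xs

-- countVs g f counts V_t.
countVs-swap : ∀ {n} (f g : Coloring n) → Consistent f g → countVs g f ≡ countVs f g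
countVs-swap {n} f g (same-c1 , _) = +-cancelʳ-≡ _ _ _ (begin
    countVs g f + count (λ u → (f u ≟ᶜ c1) ×-dec (g u ≟ᶜ c1))
  ≡⟨ cong (countVs g f +_) (cong length (filter-≐ _ _ (swap , swap) (allFin n))) ⟨
    countVs g f + count (λ u → (g u ≟ᶜ c1) ×-dec (f u ≟ᶜ c1))
  ≡⟨ count-c1 g f (allFin n) ⟨
    countColor g c1
  ≡⟨ same-c1 ⟨
    countColor f c1
  ≡⟨ count-c1 f g (allFin n) ⟩
    countVs f g + count (λ u → (f u ≟ᶜ c1) ×-dec (g u ≟ᶜ c1))
  ∎)
  where
  open ≡-Reasoning
  count : ∀ {P : Fin n → Set} → Decidable P → ℕ
  count P? = length (filter P? (allFin n))

module WalksInH {n} (G : Graph n) (f g : Coloring n) where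

  Cls : Fin n → Class
  Cls u = cls (f u) (g u)

  walk-link-arc : ∀ x us {u v} → WalkTo-t G f g x us → (u , v) ∈ links us → Arc G f g (inj₁ u) (inj₁ v)
  walk-link-arc x (y ∷ z ∷ zs) (_ , walk) (here refl) = proj₁ walk
  walk-link-arc x (y ∷ z ∷ zs) (_ , walk) (there uv)  = walk-link-arc (inj₁ y) (z ∷ zs) walk uv

  walk-successor : ∀ x us {u} → WalkTo-t G f g x us → u ∈ us → Cls u ≡ Vt ⊎ ∃ λ v → (u , v) ∈ links us
  walk-successor x (y ∷ [])     (_ , y→t) (here refl) = inj₁ y→t
  walk-successor x (y ∷ z ∷ zs) _         (here refl) = inj₂ (z , here refl)
  walk-successor x (y ∷ z ∷ zs) (_ , walk) (there u∈) with walk-successor (inj₁ y) (z ∷ zs) walk u∈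
  ... | inj₁ u∈Vt     = inj₁ u∈Vt
  ... | inj₂ (v , uv) = inj₂ (v , there uv)

  walk-predecessor : ∀ us {u} → WalkTo-t G f g (inj₂ s) us → u ∈ us → Cls u ≡ Vs ⊎ ∃ λ w → (w , u) ∈ links us
  walk-predecessor (y ∷ ys) (s→y , _) u∈ with ∈⇒head⊎linked y ys u∈
  ... | inj₁ refl = inj₁ s→y
  ... | inj₂ wu   = inj₂ wu

  walk-meets-Vt : ∀ x y ys → WalkTo-t G f g x (y ∷ ys) → ∃ λ z → z ∈ y ∷ ys × Cls z ≡ Vt
  walk-meets-Vt x y []       (_ , y→t) = y , here refl , y→t
  walk-meets-Vt x y (z ∷ zs) (_ , walk) with walk-meets-Vt (inj₁ y) z zs walk
  ... | w , w∈ , w∈Vt = w , there w∈ , w∈Vt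

-- Orbits of an injective partial map

module Orbit {n} (next : Fin n → Maybe (Fin n))
             (next-injective : ∀ {x y z} → next x ≡ just z → next y ≡ just z → x ≡ y) where

  iterate : Fin n → ℕ → Maybe (Fin n)
  iterate a zero    = just a
  iterate a (suc i) = iterate a i >>= next

  Source : Fin n → Set
  Source a = ∀ x → next x ≢ just a

  iterate-step : ∀ a i {x y} → iterate a i ≡ just x → next x ≡ just y → iterate a (suc i) ≡ just y
  iterate-step a i ax xy = trans (cong (_>>= next) ax) xy

  iterate-step⁻ : ∀ a i {y} → iterate a (suc i) ≡ just y → ∃ λ x → iterate a i ≡ just x × next x ≡ just y
  iterate-step⁻ a i ay with iterate a i
  ... | just x = x , refl , ay

  iterate-injective : ∀ {a b} → Source a → Source b → ∀ i j {u} →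
                      iterate a i ≡ just u → iterate b j ≡ just u → a ≡ b × i ≡ j
  iterate-injective _    _    zero    zero    refl refl = refl , refl
  iterate-injective srca _    zero    (suc j) refl bu with iterate-step⁻ _ j bu
  ... | x , _ , xa = ⊥-elim (srca x xa)
  iterate-injective _    srcb (suc i) zero    au refl with iterate-step⁻ _ i au
  ... | x , _ , xb = ⊥-elim (srcb x xb)
  iterate-injective srca srcb (suc i) (suc j) au bu with iterate-step⁻ _ i au | iterate-step⁻ _ j bu
  ... | x , ax , xu | y , by , yu with refl ← next-injective xu yu with a≡b , refl ← iterate-injective srca srcb i j ax by
      = a≡b , refl

  iterate-defined-below : ∀ a m i {u} → iterate a (m + i) ≡ just u → ∃ λ x → iterate a i ≡ just x
  iterate-defined-below a zero    i au = _ , au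
  iterate-defined-below a (suc m) i au = iterate-defined-below a m i (proj₁ (proj₂ (iterate-step⁻ a (m + i) au)))

  -- Otherwise the n + 1 vertices reached in 0, …, n steps would be distinct.
  iterate-halts : ∀ {a} → Source a → iterate a n ≡ nothing
  iterate-halts {a} src with iterate a n in an
  ... | nothing = refl
  ... | just x  = ⊥-elim (≤⇒≯ ≤-refl (injective⇒≤ {f = visited} visited-injective))
    where
    reached : (i : Fin (suc n)) → ∃ λ y → iterate a (toℕ i) ≡ just y
    reached i = iterate-defined-below a (n ∸ toℕ i) (toℕ i) (subst (λ m → iterate a m ≡ just x) (sym (m∸n+n≡m (toℕ≤pred[n] i))) an)
    visited : Fin (suc n) → Fin n
    visited i = proj₁ (reached i)
    visited-injective : ∀ {i j} → visited i ≡ visited j → i ≡ j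
    visited-injective {i} {j} eq =
      toℕ-injective (proj₂ (iterate-injective src src (toℕ i) (toℕ j) (subst (λ y → iterate a (toℕ i) ≡ just y) eq (proj₂ (reached i))) (proj₂ (reached j))))

  successors : ℕ → Fin n → List (Fin n)
  successors zero    x = []
  successors (suc k) x with next x
  ... | nothing = []
  ... | just y  = y ∷ successors k y

  orbit : Fin n → List (Fin n)
  orbit a = a ∷ successors n a

  ∈-successors : ∀ a k i {x u} → iterate a i ≡ just x → u ∈ successors k x → ∃ λ j → iterate a j ≡ just u × i < j
  ∈-successors a (suc k) i {x} ax u∈ with next x in xy
  ∈-successors a (suc k) i ax (here refl) | just y = suc i , iterate-step a i ax xy , ≤-refl
  ∈-successors a (suc k) i ax (there u∈)  | just y with ∈-successors a k (suc i) (iterate-step a i ax xy) u∈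
  ... | j , au , i<j = j , au , <⇒≤ i<j

  trail-unique : ∀ {a} → Source a → ∀ k i {x} → iterate a i ≡ just x → Unique (x ∷ successors k x)
  trail-unique {a} src k i {x} ax = All.tabulate fresh ∷ rest k
    where
    fresh : ∀ {u} → u ∈ successors k x → x ≢ u
    fresh u∈ refl with ∈-successors a k i ax u∈
    ... | j , au , i<j = <-irrefl (proj₂ (iterate-injective src src i j ax au)) i<j
    rest : ∀ k → Unique (successors k x)
    rest zero = []
    rest (suc k) with next x in xy
    ... | nothing = []
    ... | just y  = trail-unique src k (suc i) (iterate-step a i ax xy)

  orbit-unique : ∀ {a} → Source a → Unique (orbit a)
  orbit-unique src = trail-unique src n 0 refl

  ∈-orbit : ∀ {a u} → u ∈ orbit a → ∃ λ j → iterate a j ≡ just u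
  ∈-orbit (here refl) = 0 , refl
  ∈-orbit {a} (there u∈) with ∈-successors a n 0 refl u∈
  ... | j , au , _ = j , au

  orbits-disjoint : ∀ {a b u} → Source a → Source b → u ∈ orbit a → u ∈ orbit b → a ≡ b
  orbits-disjoint srca srcb u∈a u∈b with ∈-orbit u∈a | ∈-orbit u∈b
  ... | i , au | j , bu = proj₁ (iterate-injective srca srcb i j au bu)

-- From matchings to paths

-- The arguments are the colours of a vertex under f, f S₁ and g, followed by its S₁- and S₂-mates.
move : ∀ {A : Set} → Color → Color → Color → A → A → Maybe A
move c1 c2 _  x _ = just x
move _  c1 c2 _ y = just y
move _  _  _  _ _ = nothing

move-cases : ∀ {A : Set} a b c (x y v : A) → move a b c x y ≡ just v →
             (a ≡ c1 × b ≡ c2 × x ≡ v) ⊎ (b ≡ c1 × c ≡ c2 × y ≡ v)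
move-cases c1 c2 c1 x y v refl = inj₁ (refl , refl , refl)
move-cases c1 c2 c2 x y v refl = inj₁ (refl , refl , refl)
move-cases c1 c1 c2 x y v refl = inj₂ (refl , refl , refl)
move-cases c2 c1 c2 x y v refl = inj₂ (refl , refl , refl)
move-cases c1 c1 c1 x y v ()
move-cases c2 c1 c1 x y v ()
move-cases c2 c2 c1 x y v ()
move-cases c2 c2 c2 x y v ()

-- The colours (under f, f S₁, g) of a vertex that hands colour 2 on in the first or in the second step.
Entered : Color → Color → Color → Set
Entered a b c = (a ≡ c2 × b ≡ c1) ⊎ (b ≡ c2 × c ≡ c1)

move-halts-in-Vt : ∀ {A : Set} a b c (x y : A) → move a b c x y ≡ nothing →
                   cls a c ≡ Vs ⊎ Entered a b c → cls a c ≡ Vt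
move-halts-in-Vt c2 _  c1 x y _ _ = refl
move-halts-in-Vt c1 c1 c2 x y () _
move-halts-in-Vt c1 c2 c2 x y () _
move-halts-in-Vt c2 c1 c2 x y () _
move-halts-in-Vt c1 c1 c1 x y _ (inj₁ ())
move-halts-in-Vt c1 c1 c1 x y _ (inj₂ (inj₁ ()))
move-halts-in-Vt c1 c1 c1 x y _ (inj₂ (inj₂ ()))
move-halts-in-Vt c2 c2 c2 x y _ (inj₁ ())
move-halts-in-Vt c2 c2 c2 x y _ (inj₂ (inj₁ ()))
move-halts-in-Vt c2 c2 c2 x y _ (inj₂ (inj₂ ()))
module FromMatchings {n} (G : Graph n) (f g : Coloring n) (S₁ S₂ : Matching G)
                     (f⟨S₁,S₂⟩≡g : ∀ u → apply₂ f S₁ S₂ u ≡ g u) where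

  open WalksInH G f g using (Cls)

  σ₁ σ₂ : Fin n → Fin n
  σ₁ = mate S₁
  σ₂ = mate S₂

  h : Coloring n
  h u = f (σ₁ u)

  g≡h∘σ₂ : ∀ u → g u ≡ h (σ₂ u)
  g≡h∘σ₂ u = trans (sym (f⟨S₁,S₂⟩≡g u)) (apply₂-mate S₁ S₂ f u)

  -- next w is the vertex from which w receives colour 2: its S₁-mate if that happens in the first step, its S₂-mate if in the second.
  next : Fin n → Maybe (Fin n)
  next w = move (f w) (h w) (g w) (σ₁ w) (σ₂ w)

  next-cases : ∀ {w v} → next w ≡ just v → (f w ≡ c1 × h w ≡ c2 × σ₁ w ≡ v) ⊎ (h w ≡ c1 × g w ≡ c2 × σ₂ w ≡ v)
  next-cases {w} {v} = move-cases (f w) (h w) (g w) (σ₁ w) (σ₂ w) v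

  first-move-colours : ∀ {w} → f w ≡ c1 → h w ≡ c2 → f (σ₁ w) ≡ c2 × h (σ₁ w) ≡ c1
  first-move-colours {w} fw hw = hw , trans (cong f (mate-involutive S₁ w)) fw

  second-move-colours : ∀ {w} → h w ≡ c1 → g w ≡ c2 → h (σ₂ w) ≡ c2 × g (σ₂ w) ≡ c1
  second-move-colours {w} hw gw = trans (sym (g≡h∘σ₂ w)) gw , trans (g≡h∘σ₂ (σ₂ w)) (trans (cong h (mate-involutive S₂ w)) hw)

  next-entered : ∀ {w v} → next w ≡ just v → Entered (f v) (h v) (g v)
  next-entered wv with next-cases wv
  ... | inj₁ (fw , hw , refl) = inj₁ (first-move-colours fw hw)
  ... | inj₂ (hw , gw , refl) = inj₂ (second-move-colours hw gw)

  next-injective : ∀ {x y z} → next x ≡ just z → next y ≡ just z → x ≡ y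
  next-injective {x} {y} xz yz with next-cases xz | next-cases yz
  ... | inj₁ (_ , _ , σx) | inj₁ (_ , _ , σy) = mate-injective S₁ (trans σx (sym σy))
  ... | inj₂ (_ , _ , σx) | inj₂ (_ , _ , σy) = mate-injective S₂ (trans σx (sym σy))
  ... | inj₁ (fx , hx , refl) | inj₂ (hy , gy , σy)
        with () ← trans (sym (proj₂ (first-move-colours fx hx))) (subst (λ z → h z ≡ c2) σy (proj₁ (second-move-colours hy gy)))
  ... | inj₂ (hx , gx , refl) | inj₁ (fy , hy , σy)
        with () ← trans (sym (proj₂ (first-move-colours fy hy))) (subst (λ z → h z ≡ c2) (sym σy) (proj₁ (second-move-colours hx gx)))

  next-arc : ∀ {w v} → next w ≡ just v → Arc G f g (inj₁ w) (inj₁ v)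
  next-arc {w} wv with next-cases wv
  ... | inj₁ (fw , hw , refl) = mate-adjacent S₁ w (λ σw≡w → c1≢c2 (trans (sym fw) (trans (cong f (sym σw≡w)) hw)))
                              , ArcOK⁺ (inj₁ (fw , proj₁ (first-move-colours fw hw)))
  ... | inj₂ (hw , gw , refl) = mate-adjacent S₂ w (λ σw≡w → c1≢c2 (trans (sym hw) (trans (cong h (sym σw≡w)) (trans (sym (g≡h∘σ₂ w)) gw))))
                              , ArcOK⁺ (inj₂ (gw , proj₂ (second-move-colours hw gw)))

  open Orbit next next-injective

  Vs-source : ∀ {a} → f a ≡ c1 → g a ≡ c2 → Source a
  Vs-source fa ga x xa with next-entered xa
  ... | inj₁ (fa′ , _) = c1≢c2 (trans (sym fa) fa′)
  ... | inj₂ (_ , ga′) = c1≢c2 (trans (sym ga′) ga)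

  successors-walk : ∀ {a} → Source a → ∀ k i {x} → iterate a i ≡ just x → k + i ≡ n →
                    Cls x ≡ Vs ⊎ Entered (f x) (h x) (g x) → WalkTo-t G f g (inj₁ x) (successors k x)
  successors-walk src zero    i ax refl _ with () ← trans (sym ax) (iterate-halts src)
  successors-walk src (suc k) i {x} ax k+i≡n reached with next x in xy
  ... | nothing = move-halts-in-Vt (f x) (h x) (g x) (σ₁ x) (σ₂ x) xy reached
  ... | just y  = next-arc xy , successors-walk src k (suc i) (iterate-step _ i ax xy) (trans (+-suc k i) k+i≡n) (inj₂ (next-entered xy))

  orbit-path : ∀ {a} → f a ≡ c1 → g a ≡ c2 → STPath G f g (orbit a)
  orbit-path {a} fa ga = (a∈Vs , successors-walk (Vs-source fa ga) n 0 refl (+-identityʳ n) (inj₁ a∈Vs)) , orbit-unique (Vs-source fa ga)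
    where
    a∈Vs : Cls a ≡ Vs
    a∈Vs = cls≡Vs⁺ fa ga

  Vs? : Decidable (λ u → f u ≡ c1 × g u ≡ c2)
  Vs? u = (f u ≟ᶜ c1) ×-dec (g u ≟ᶜ c2)

  source : Fin (countVs f g) → Fin n
  source = lookup (filter Vs? (allFin n))

  source-in-Vs : ∀ i → f (source i) ≡ c1 × g (source i) ≡ c2
  source-in-Vs i = proj₂ (∈-filter⁻ Vs? {xs = allFin n} (∈-lookup i))

  source-source : ∀ i → Source (source i)
  source-source i = Vs-source (proj₁ (source-in-Vs i)) (proj₂ (source-in-Vs i))

  paths : DisjointPaths G f g (countVs f g)
  paths = (λ i → orbit (source i))
        , (λ i → orbit-path (proj₁ (source-in-Vs i)) (proj₂ (source-in-Vs i)))
        , λ i j i≢j u u∈i u∈j → i≢j (lookup-injective (filter⁺ Vs? (allFin⁺ n)) i j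
                                        (orbits-disjoint (source-source i) (source-source j) u∈i u∈j))

-- From paths to matchings

module FromPaths {n} (G : Graph n) (f g : Coloring n) (consistent : Consistent f g)
                 (P : Fin (countVs f g) → List (Fin n))
                 (paths : ∀ i → STPath G f g (P i))
                 (disjoint : PairwiseDisjoint P) where

  open WalksInH G f g

  Link : Fin n → Fin n → Set
  Link u v = ∃ λ i → (u , v) ∈ links (P i)

  Link? : ∀ u v → Dec (Link u v)
  Link? u v = any? (λ i → (u , v) ∈? links (P i))
    where open DecMembership (≡-dec _≟_ _≟_)

  OnPath : Fin n → Set
  OnPath u = ∃ λ i → u ∈ P i

  OnPath? : ∀ u → Dec (OnPath u)
  OnPath? u = any? (λ i → u ∈? P i)
    where open DecMembership (_≟_ {n})

  link-functional : ∀ {u v w} → Link u v → Link u w → v ≡ w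
  link-functional {u} (i , uv) (j , uw) with i ≟ j
  ... | yes refl = links-functional (P i) (proj₂ (paths i)) uv uw
  ... | no i≢j   = ⊥-elim (disjoint i j i≢j u (proj₁ (∈-links⁻ (P i) uv)) (proj₁ (∈-links⁻ (P j) uw)))

  link-injective : ∀ {u v w} → Link u w → Link v w → u ≡ v
  link-injective {w = w} (i , uw) (j , vw) with i ≟ j
  ... | yes refl = links-injective (P i) (proj₂ (paths i)) uw vw
  ... | no i≢j   = ⊥-elim (disjoint i j i≢j w (proj₂ (∈-links⁻ (P i) uw)) (proj₂ (∈-links⁻ (P j) vw)))

  link-arc : ∀ {u v} → Link u v → Arc G f g (inj₁ u) (inj₁ v)
  link-arc (i , uv) = walk-link-arc (inj₂ s) (P i) (proj₁ (paths i)) uv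

  link-from-Vt : ∀ {u v} → Cls u ≡ Vt → ¬ Link u v
  link-from-Vt {v = v} u∈Vt uv = ¬ArcOK-from-Vt (Cls v) (subst (λ x → ArcOK x (Cls v)) u∈Vt (proj₂ (link-arc uv)))

  link-into-Vs : ∀ {u v} → Cls v ≡ Vs → ¬ Link u v
  link-into-Vs {u} v∈Vs uv = ¬ArcOK-into-Vs (Cls u) (subst (ArcOK (Cls u)) v∈Vs (proj₂ (link-arc uv)))

  source-on-path : ∀ {u v} → Link u v → OnPath u
  source-on-path (i , uv) = i , proj₁ (∈-links⁻ (P i) uv)

  target-on-path : ∀ {u v} → Link u v → OnPath v
  target-on-path (i , uv) = i , proj₂ (∈-links⁻ (P i) uv)

  successor-or-Vt : ∀ {u} → OnPath u → Cls u ≡ Vt ⊎ ∃ (Link u)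
  successor-or-Vt (i , u∈) with walk-successor (inj₂ s) (P i) (proj₁ (paths i)) u∈
  ... | inj₁ u∈Vt     = inj₁ u∈Vt
  ... | inj₂ (v , uv) = inj₂ (v , i , uv)

  predecessor-or-Vs : ∀ {u} → OnPath u → Cls u ≡ Vs ⊎ ∃ λ w → Link w u
  predecessor-or-Vs (i , u∈) with walk-predecessor (P i) (proj₁ (paths i)) u∈
  ... | inj₁ u∈Vs     = inj₁ u∈Vs
  ... | inj₂ (w , wu) = inj₂ (w , i , wu)

  -- Every path starts in V_s and passes through V_t, and there are as many paths as either class has vertices.
  Vs-on-path : ∀ {u} → Cls u ≡ Vs → OnPath u
  Vs-on-path u∈Vs = disjoint-cover (λ u → (f u ≟ᶜ c1) ×-dec (g u ≟ᶜ c2)) P disjoint start ≤-refl (cls≡Vs⁻ u∈Vs)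
    where
    start : ∀ i → ∃ λ x → x ∈ P i × (f x ≡ c1 × g x ≡ c2)
    start i with P i | proj₁ (paths i)
    ... | y ∷ _ | s→y , _ = y , here refl , cls≡Vs⁻ s→y

  Vt-on-path : ∀ {u} → Cls u ≡ Vt → OnPath u
  Vt-on-path u∈Vt = disjoint-cover (λ u → (g u ≟ᶜ c1) ×-dec (f u ≟ᶜ c2)) P disjoint end
                                   (≤-reflexive (countVs-swap f g consistent)) (swap (cls≡Vt⁻ u∈Vt))
    where
    end : ∀ i → ∃ λ x → x ∈ P i × (g x ≡ c1 × f x ≡ c2)
    end i with P i | proj₁ (paths i)
    ... | y ∷ ys | walk with walk-meets-Vt (inj₂ s) y ys walk
    ...   | z , z∈ , z∈Vt = z , z∈ , swap (cls≡Vt⁻ z∈Vt)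

  -- S₁ consists of the links raising f from 1 to 2, S₂ of the others, which lower g from 2 to 1.
  Step : Bool → Fin n → Fin n → Set
  Step b u v = Link u v × raises (f u) (f v) ≡ b

  Step? : ∀ b u v → Dec (Step b u v)
  Step? b u v = Link? u v ×-dec (raises (f u) (f v) Bool.≟ b)

  step-of-link : ∀ {u v} → Link u v → ∃ λ b → Step b u v
  step-of-link {u} {v} uv = raises (f u) (f v) , uv , refl

  no-consecutive-steps : ∀ b {u v w} → Step b u v → Step b v w → ⊥
  no-consecutive-steps true  (_ , r) (_ , r′) with () ← trans (sym (proj₂ (raises≡true r))) (proj₁ (raises≡true r′))
  no-consecutive-steps false (uv , r) (vw , r′)
    with () ← trans (sym (proj₂ (ArcOK-lowers (proj₂ (link-arc uv)) r))) (proj₁ (ArcOK-lowers (proj₂ (link-arc vw)) r′))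

  Joined : Bool → Fin n → Fin n → Set
  Joined b u v = Step b u v ⊎ Step b v u

  Joined-functional : ∀ b {u v w} → Joined b u v → Joined b u w → v ≡ w
  Joined-functional b (inj₁ uv) (inj₁ uw) = link-functional (proj₁ uv) (proj₁ uw)
  Joined-functional b (inj₂ vu) (inj₂ wu) = link-injective (proj₁ vu) (proj₁ wu)
  Joined-functional b (inj₁ uv) (inj₂ wu) = ⊥-elim (no-consecutive-steps b wu uv)
  Joined-functional b (inj₂ vu) (inj₁ uw) = ⊥-elim (no-consecutive-steps b vu uw)

  Joined⇒Adj : ∀ b {u v} → Joined b u v → Adj G u v
  Joined⇒Adj b (inj₁ uv) = proj₁ (link-arc (proj₁ uv))
  Joined⇒Adj b (inj₂ vu) = Graph.sym G (proj₁ (link-arc (proj₁ vu)))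

  Joined? : ∀ b u v → Dec (Joined b u v)
  Joined? b u v = Step? b u v ⊎-dec Step? b v u

  module Matched (b : Bool) = FromRelation G (Joined b) (Joined? b) ⊎-swap (Joined-functional b) (Joined⇒Adj b)
  open Matched using (matching; mate-matching; mate-unrelated)

  S₁ S₂ : Matching G
  S₁ = matching true
  S₂ = matching false

  σ₁ σ₂ : Fin n → Fin n
  σ₁ = mate S₁
  σ₂ = mate S₂

  mate-step : ∀ b {u v} → Step b u v → mate (matching b) u ≡ v × mate (matching b) v ≡ u
  mate-step b uv = mate-matching b (inj₁ uv) , mate-matching b (inj₂ uv)

  raising-step : ∀ {u v} → Link u v → ¬ Step false u v → Step true u v
  raising-step uv ¬lowering with step-of-link uv
  ... | true  , step = step
  ... | false , step = ⊥-elim (¬lowering step)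

  σ₁-at-lowered-head : ∀ {u v} → Step false u v → f (σ₁ v) ≡ c2
  σ₁-at-lowered-head {u} {v} uv with successor-or-Vt (target-on-path (proj₁ uv))
  ... | inj₁ v∈Vt = trans (cong f (mate-unrelated true unjoined)) (proj₁ (cls≡Vt⁻ v∈Vt))
    where
    unjoined : ∀ x → ¬ Joined true v x
    unjoined x (inj₁ (vx , _)) = link-from-Vt v∈Vt vx
    unjoined x (inj₂ (xv , r)) with refl ← link-injective xv (proj₁ uv) with () ← trans (sym r) (proj₂ uv)
  ... | inj₂ (y , vy) with raising-step vy (no-consecutive-steps false uv)
  ...   | vy↑ = trans (cong f (proj₁ (mate-step true vy↑))) (proj₂ (raises≡true (proj₂ vy↑)))

  σ₁-at-lowered-tail : ∀ {u w} → Step false w u → f (σ₁ w) ≡ c1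
  σ₁-at-lowered-tail {u} {w} wu with predecessor-or-Vs (source-on-path (proj₁ wu))
  ... | inj₁ w∈Vs = trans (cong f (mate-unrelated true unjoined)) (proj₁ (cls≡Vs⁻ w∈Vs))
    where
    unjoined : ∀ x → ¬ Joined true w x
    unjoined x (inj₁ (wx , r)) with refl ← link-functional wx (proj₁ wu) with () ← trans (sym r) (proj₂ wu)
    unjoined x (inj₂ (xw , _)) = link-into-Vs w∈Vs xw
  ... | inj₂ (x , xw) with raising-step xw (λ xw↓ → no-consecutive-steps false xw↓ wu)
  ...   | xw↑ = trans (cong f (proj₂ (mate-step true xw↑))) (proj₁ (raises≡true (proj₂ xw↑)))

  σ₁-at-unlowered : ∀ {u} → (∀ v → ¬ Step false u v) → (∀ w → ¬ Step false w u) → f (σ₁ u) ≡ g u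
  σ₁-at-unlowered {u} ∄out ∄in with OnPath? u
  ... | no off = trans (cong f (mate-unrelated true unlinked))
                       (cls-unchanged (f u) (g u) (λ u∈Vs → off (Vs-on-path u∈Vs)) (λ u∈Vt → off (Vt-on-path u∈Vt)))
    where
    unlinked : ∀ x → ¬ Joined true u x
    unlinked x (inj₁ (ux , _)) = off (source-on-path ux)
    unlinked x (inj₂ (xu , _)) = off (target-on-path xu)
  ... | yes on with successor-or-Vt on | predecessor-or-Vs on
  ...   | inj₂ (v , uv) | inj₂ (w , wu) =
          ⊥-elim (no-consecutive-steps true (raising-step wu (∄in w)) (raising-step uv (∄out v)))
  ...   | inj₂ (v , uv) | inj₁ u∈Vs =
          trans (cong f (proj₁ (mate-step true uv↑))) (trans (proj₂ (raises≡true (proj₂ uv↑))) (sym (proj₂ (cls≡Vs⁻ u∈Vs))))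
    where uv↑ = raising-step uv (∄out v)
  ...   | inj₁ u∈Vt | inj₂ (w , wu) =
          trans (cong f (proj₂ (mate-step true wu↑))) (trans (proj₁ (raises≡true (proj₂ wu↑))) (sym (proj₂ (cls≡Vt⁻ u∈Vt))))
    where wu↑ = raising-step wu (∄in w)
  ...   | inj₁ u∈Vt | inj₁ u∈Vs with () ← trans (sym u∈Vs) u∈Vt

  f∘σ₁∘σ₂≡g : ∀ u → f (σ₁ (σ₂ u)) ≡ g u
  f∘σ₁∘σ₂≡g u with any? (Step? false u) | any? (λ w → Step? false w u)
  ... | yes (v , uv) | _ = trans (cong (f ∘ σ₁) (proj₁ (mate-step false uv)))
                                 (trans (σ₁-at-lowered-head uv) (sym (proj₁ (ArcOK-lowers (proj₂ (link-arc (proj₁ uv))) (proj₂ uv)))))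
  ... | no _ | yes (w , wu) = trans (cong (f ∘ σ₁) (proj₂ (mate-step false wu)))
                                 (trans (σ₁-at-lowered-tail wu) (sym (proj₂ (ArcOK-lowers (proj₂ (link-arc (proj₁ wu))) (proj₂ wu)))))
  ... | no ∄out | no ∄in = trans (cong (f ∘ σ₁) (mate-unrelated false unjoined)) (σ₁-at-unlowered (λ v uv → ∄out (v , uv)) (λ w wu → ∄in (w , wu)))
    where
    unjoined : ∀ x → ¬ Joined false u x
    unjoined x (inj₁ ux) = ∄out (x , ux)
    unjoined x (inj₂ xu) = ∄in (x , xu)

  matchings : ∃₂ λ (S₁ S₂ : Matching G) → ∀ u → apply₂ f S₁ S₂ u ≡ g u
  matchings = S₁ , S₂ , λ u → trans (apply₂-mate S₁ S₂ f u) (f∘σ₁∘σ₂≡g u)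

lemma9 : ∀ {n} (G : Graph n) (f g : Coloring n) → Consistent f g →
           (∃₂ λ (S₁ S₂ : Matching G) → ∀ u → apply₂ f S₁ S₂ u ≡ g u)
           ⇔ DisjointPaths G f g (countVs f g)
lemma9 G f g consistent = mk⇔
  (λ (S₁ , S₂ , f⟨S₁,S₂⟩≡g) → FromMatchings.paths G f g S₁ S₂ f⟨S₁,S₂⟩≡g)
  (λ (P , paths , disjoint) → FromPaths.matchings G f g consistent P paths disjoint)
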